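{- For every integer $n\ge1$, the packing number of $C_5\Box P_n$ equals $n$, i.e. $\rho(C_5\Box P_n)=n$.
   Context: A set $D\subseteq V(G)$ is a packing if $N[u]\cap N[v]=\emptyset$ for all distinct $u,v\in D$, where $N[v]$ is the closed neighborhood of $v$; the packing number $\rho(G)$ is the maximum size of a packing. $C_5\Box P_n$ is the Cartesian product of the cycle $C_5$ (vertices $0,\dots,4$ mod $5$) and the path $P_n$ (vertices $0,\dots,n-1$): $(i,j)\sim(i',j')$ iff ($i=i'$ and $|j-j'|=1$) or ($j=j'$ and $i'\equiv i\pm1 \pmod 5$). -}

module Defs where

open import Data.Nat using (ℕ; suc; _≤_)
import Data.Nat
open import Data.Fin using (Fin; toℕ)
open import Data.Product using (_×_; _,_; ∃-syntax)
open import Data.Sum using (_⊎_)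
open import Data.List using (List; length)
open import Data.List.Membership.Propositional using (_∈_)
open import Data.List.Relation.Unary.Unique.Propositional using (Unique)
open import Relation.Binary.PropositionalEquality using (_≡_; _≢_)
open import Relation.Nullary using (¬_)

Vertex : ℕ → Set
Vertex n = Fin 5 × Fin n

CycAdj : Fin 5 → Fin 5 → Set
CycAdj i i' = (Data.Nat._%_ (suc (toℕ i)) 5 ≡ toℕ i') ⊎ (Data.Nat._%_ (suc (toℕ i')) 5 ≡ toℕ i)

PathAdj : {n : ℕ} → Fin n → Fin n → Set
PathAdj j j' = (suc (toℕ j) ≡ toℕ j') ⊎ (suc (toℕ j') ≡ toℕ j)

Adj : {n : ℕ} → Vertex n → Vertex n → Set
Adj (i , j) (i' , j') = ((i ≡ i') × PathAdj j j') ⊎ ((j ≡ j') × CycAdj i i')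

InClosedNbhd : {n : ℕ} → Vertex n → Vertex n → Set
InClosedNbhd w v = (w ≡ v) ⊎ Adj v w

IsPacking : (n : ℕ) → List (Vertex n) → Set
IsPacking n D = Unique D × (∀ u v → u ∈ D → v ∈ D → u ≢ v →
  ∀ (w : Vertex n) → ¬ (InClosedNbhd w u × InClosedNbhd w v))

PackingNumberIs : (n k : ℕ) → Set
PackingNumberIs n k = (∃[ D ] (IsPacking n D × length D ≡ k))
  × (∀ D → IsPacking n D → length D ≤ k)

-- Two vertices in the same column of C₅ □ Pₙ always share a closed neighbour,
-- because C₅ has diameter 2; hence a packing has at most one vertex per column,
-- i.e. at most n vertices. Conversely, putting one vertex in each column j, in
-- row 2j mod 5, gives a packing: rows of consecutive columns are at cycle
-- distance 2, and rows of columns two apart are distinct, so no two chosen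
-- vertices are within distance 2 of each other.
module Submission where

open import Defs
open import Data.Nat using (ℕ; _≤_; zero; suc; _%_) renaming (_≟_ to _≟ℕ_)
open import Data.Nat.Properties using (suc-injective)
open import Data.Fin using (Fin; toℕ; _≟_)
import Data.Fin as F
open import Data.Fin.Properties using (all?; any?; injective⇒≤; toℕ-injective)
open import Data.Product using (_×_; _,_; ∃-syntax; proj₁; proj₂)
open import Data.Sum using (_⊎_; inj₁; inj₂)
open import Data.List using (List; length; lookup; tabulate; _∷_)
open import Data.List.Properties using (length-tabulate)
open import Data.List.Membership.Propositional using (_∈_)
open import Data.List.Membership.Propositional.Properties using (∈-lookup; ∈-tabulate⁻)
open import Data.List.Relation.Unary.Unique.Propositional using (Unique)
open import Data.List.Relation.Unary.Unique.Propositional.Properties using (tabulate⁺)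
open import Data.List.Relation.Unary.AllPairs using (_∷_)
import Data.List.Relation.Unary.All as All
open import Data.Empty using (⊥-elim)
open import Function using (_∘_)
open import Relation.Binary.PropositionalEquality using (_≡_; _≢_; refl; sym; trans; cong)
open import Relation.Nullary using (¬_; yes; no)
open import Relation.Nullary.Decidable using (from-yes; _⊎-dec_; _×-dec_; ¬?)
open import Relation.Binary.Definitions using (Decidable)

CycClosedNbhd : Fin 5 → Fin 5 → Set
CycClosedNbhd c a = (c ≡ a) ⊎ CycAdj a c

CycClosedNbhd-sym : ∀ {a c} → CycClosedNbhd c a → CycClosedNbhd a c
CycClosedNbhd-sym (inj₁ c≡a)       = inj₁ (sym c≡a)
CycClosedNbhd-sym (inj₂ (inj₁ ac)) = inj₂ (inj₂ ac)
CycClosedNbhd-sym (inj₂ (inj₂ ca)) = inj₂ (inj₁ ca)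

CycAdj? : Decidable CycAdj
CycAdj? a c = (suc (toℕ a) % 5 ≟ℕ toℕ c) ⊎-dec (suc (toℕ c) % 5 ≟ℕ toℕ a)

CycClosedNbhd? : Decidable CycClosedNbhd
CycClosedNbhd? c a = (c ≟ a) ⊎-dec CycAdj? a c

C₅-diameter≤2 : ∀ a b → ∃[ c ] (CycClosedNbhd c a × CycClosedNbhd c b)
C₅-diameter≤2 = from-yes (all? λ a → all? λ b → any? λ c →
  CycClosedNbhd? c a ×-dec CycClosedNbhd? c b)

InClosedNbhd-sameColumn : ∀ {n} {a c} {j : Fin n} →
  CycClosedNbhd c a → InClosedNbhd (c , j) (a , j)
InClosedNbhd-sameColumn (inj₁ refl) = inj₁ refl
InClosedNbhd-sameColumn (inj₂ ac)   = inj₂ (inj₂ (refl , ac))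

InClosedNbhd-cases : ∀ {n} {a c} {j l : Fin n} → InClosedNbhd (c , l) (a , j) →
  (l ≡ j × CycClosedNbhd c a) ⊎ (c ≡ a × PathAdj j l)
InClosedNbhd-cases (inj₁ refl)              = inj₁ (refl , inj₁ refl)
InClosedNbhd-cases (inj₂ (inj₁ (a≡c , jl))) = inj₂ (sym a≡c , jl)
InClosedNbhd-cases (inj₂ (inj₂ (j≡l , ac))) = inj₁ (sym j≡l , inj₂ ac)

packing-sameColumn⇒≡ : ∀ {n D} → IsPacking n D → ∀ {x y} → x ∈ D → y ∈ D →
  proj₂ x ≡ proj₂ y → x ≡ y
packing-sameColumn⇒≡ (_ , disjoint) {a , j} {b , .j} x∈D y∈D refl with a ≟ b
... | yes refl = refl
... | no a≢b   =
  let c , ca , cb = C₅-diameter≤2 a b in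
  ⊥-elim (disjoint _ _ x∈D y∈D (a≢b ∘ cong proj₁) (c , j)
    (InClosedNbhd-sameColumn ca , InClosedNbhd-sameColumn cb))

Unique⇒lookup-injective : ∀ {A : Set} {xs : List A} → Unique xs →
  ∀ i j → lookup xs i ≡ lookup xs j → i ≡ j
Unique⇒lookup-injective (_ ∷ _)    F.zero    F.zero    _  = refl
Unique⇒lookup-injective (x∉xs ∷ _) F.zero    (F.suc j) eq =
  ⊥-elim (All.lookup x∉xs (∈-lookup j) eq)
Unique⇒lookup-injective (x∉xs ∷ _) (F.suc i) F.zero    eq =
  ⊥-elim (All.lookup x∉xs (∈-lookup i) (sym eq))
Unique⇒lookup-injective (_ ∷ xs)   (F.suc i) (F.suc j) eq =
  cong F.suc (Unique⇒lookup-injective xs i j eq)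

packing-length≤ : ∀ {n D} → IsPacking n D → length D ≤ n
packing-length≤ {D = D} packing@(unique , _) = injective⇒≤ {f = proj₂ ∘ lookup D}
  λ {i} {j} sameColumn → Unique⇒lookup-injective unique i j
    (packing-sameColumn⇒≡ packing (∈-lookup i) (∈-lookup j) sameColumn)

module Staircase (row : ℕ → Fin 5)
  (step-far : ∀ J → ¬ CycClosedNbhd (row (suc J)) (row J))
  (skip-distinct : ∀ J → row J ≢ row (suc (suc J))) where

  cell : ∀ {n} → Fin n → Vertex n
  cell j = row (toℕ j) , j

  staircase : ∀ n → List (Vertex n)
  staircase n = tabulate cell

  length-staircase : ∀ n → length (staircase n) ≡ n
  length-staircase n = length-tabulate cell

  private
    far : ∀ {J K} → suc J ≡ K → ¬ CycClosedNbhd (row K) (row J)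
    far refl = step-far _

    skip : ∀ {J K} → suc (suc J) ≡ K → row J ≢ row K
    skip refl = skip-distinct _

  adjacent-far : ∀ {n} {j k : Fin n} → PathAdj j k →
    ¬ CycClosedNbhd (row (toℕ j)) (row (toℕ k))
  adjacent-far (inj₁ jk) = far jk ∘ CycClosedNbhd-sym
  adjacent-far (inj₂ kj) = far kj

  sameRow-commonNeighbour⇒≡ : ∀ {n} {j k l : Fin n} → PathAdj j l → PathAdj k l →
    row (toℕ j) ≡ row (toℕ k) → j ≡ k
  sameRow-commonNeighbour⇒≡ (inj₁ jl) (inj₁ kl) _ =
    toℕ-injective (suc-injective (trans jl (sym kl)))
  sameRow-commonNeighbour⇒≡ (inj₁ jl) (inj₂ lk) r = ⊥-elim (skip (trans (cong suc jl) lk) r)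
  sameRow-commonNeighbour⇒≡ (inj₂ lj) (inj₁ kl) r = ⊥-elim (skip (trans (cong suc kl) lj) (sym r))
  sameRow-commonNeighbour⇒≡ (inj₂ lj) (inj₂ lk) _ = toℕ-injective (trans (sym lj) lk)

  commonNeighbour⇒≡ : ∀ {n} {j k : Fin n} {w} →
    InClosedNbhd w (cell j) → InClosedNbhd w (cell k) → j ≡ k
  commonNeighbour⇒≡ wj wk with InClosedNbhd-cases wj | InClosedNbhd-cases wk
  ... | inj₁ (l≡j , _)    | inj₁ (l≡k , _)    = trans (sym l≡j) l≡k
  ... | inj₁ (refl , c∼j) | inj₂ (refl , kj)  = ⊥-elim (adjacent-far kj c∼j)
  ... | inj₂ (refl , jk)  | inj₁ (refl , c∼k) = ⊥-elim (adjacent-far jk c∼k)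
  ... | inj₂ (c≡j , jl)   | inj₂ (c≡k , kl)   = sameRow-commonNeighbour⇒≡ jl kl (trans (sym c≡j) c≡k)

  staircase-packing : ∀ n → IsPacking n (staircase n)
  staircase-packing n = tabulate⁺ (cong proj₂) , disjoint
    where
    disjoint : ∀ u v → u ∈ staircase n → v ∈ staircase n → u ≢ v →
      ∀ w → ¬ (InClosedNbhd w u × InClosedNbhd w v)
    disjoint u v u∈ v∈ u≢v w (wu , wv) with ∈-tabulate⁻ u∈ | ∈-tabulate⁻ v∈
    ... | j , refl | k , refl = u≢v (cong cell (commonNeighbour⇒≡ wu wv))

rotate2 : Fin 5 → Fin 5
rotate2 F.zero                                  = F.suc (F.suc F.zero)
rotate2 (F.suc F.zero)                          = F.suc (F.suc (F.suc F.zero))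
rotate2 (F.suc (F.suc F.zero))                  = F.suc (F.suc (F.suc (F.suc F.zero)))
rotate2 (F.suc (F.suc (F.suc F.zero)))          = F.zero
rotate2 (F.suc (F.suc (F.suc (F.suc F.zero))))  = F.suc F.zero

twiceModFive : ℕ → Fin 5
twiceModFive zero    = F.zero
twiceModFive (suc J) = rotate2 (twiceModFive J)

rotate2-far : ∀ a → ¬ CycClosedNbhd (rotate2 a) a
rotate2-far = from-yes (all? λ a → ¬? (CycClosedNbhd? (rotate2 a) a))

rotate2²-distinct : ∀ a → a ≢ rotate2 (rotate2 a)
rotate2²-distinct = from-yes (all? λ a → ¬? (a ≟ rotate2 (rotate2 a)))

open Staircase twiceModFive (rotate2-far ∘ twiceModFive) (rotate2²-distinct ∘ twiceModFive)

lemma6 : (n : ℕ) → 1 ≤ n → PackingNumberIs n n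
lemma6 n _ = (staircase n , staircase-packing n , length-staircase n) , λ _ → packing-length≤
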